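{- In the Warden's Game with position set $\mathbf{S}$ and goal $\alpha$, let $\gamma$ be a string of length $n-1$ and $a_1<a_2$ symbols with $\gamma a_1,\gamma a_2\in\mathbf{S}$. Then $r(\gamma a_1)\le r(\gamma a_2)$ (in $\{1,2,\ldots\}\cup\{\infty\}$).
   Context: $\mathbf{T}(n,k)$ is the set of strings of length $n$ over $\{1,\ldots,k\}$; $\mathbf{S}\subseteq\mathbf{T}(n,k)$ is closed under rotations (cyclic shifts), and $\alpha\in\mathbf{S}$. Warden's Game: positions are elements of $\mathbf{S}$. From a position $\gamma c$ ($\gamma$ of length $n-1$, $c$ the last symbol), the warden may either move to $c'\gamma$ for some symbol $c'<c$ with $c'\gamma\in\mathbf{S}$, or pass; if he passes, the prisoner must move to $c'\gamma$ for some symbol $c'\ge c$ with $c'\gamma\in\mathbf{S}$. The game ends (prisoner wins) as soon as the position equals $\alpha$ after some move. Remoteness: for $\beta\in\mathbf{S}$, $r(\beta)$ is the number of moves the game lasts starting from $\beta$ when both players play optimally (the prisoner minimizing and the warden maximizing the number of moves until $\alpha$ is reached after a move); $r(\beta)=\infty$ if the warden can prevent $\alpha$ from ever being reached. In particular $r(\alpha)\ge1$. -}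

module Defs where

open import Data.Nat using (ℕ; zero; suc)
import Data.Nat as ℕ
open import Data.Fin using (Fin; _<_; _≤_)
open import Data.Vec using (Vec; _∷_; _∷ʳ_)
open import Data.Product using (Σ; _×_; ∃-syntax)
open import Data.Sum using (_⊎_)
open import Data.Empty using (⊥)
open import Relation.Nullary using (¬_)
open import Relation.Binary.PropositionalEquality using (_≡_)

-- Strings of length n = suc m over the alphabet {1,…,k}, encoded as Fin k
-- (symbol i+1 is encoded as i; the order on symbols is the order on Fin k).
Str : ℕ → ℕ → Set
Str k m = Vec (Fin k) (suc m)

-- S is closed under rotations: γc ∈ S ⇒ cγ ∈ S  (generates all cyclic shifts).
RotClosed : {k m : ℕ} → (Str k m → Set) → Set
RotClosed {k} {m} S = (γ : Vec (Fin k) m) (c : Fin k) → S (γ ∷ʳ c) → S (c ∷ γ)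

-- Win S α j β : from position β the prisoner can force the game to reach α
-- (after a move) within at most j moves, whatever the warden does.
Win   : {k m : ℕ} → (Str k m → Set) → Str k m → ℕ → Str k m → Set
Reach : {k m : ℕ} → (Str k m → Set) → Str k m → ℕ → Str k m → Set

Win S α zero β = ⊥
Win {k} {m} S α (suc j) β =
  -- every warden move β = γc ↦ c'γ with c' < c, c'γ ∈ S is still winning
  ((γ : Vec (Fin k) m) (c c' : Fin k) → β ≡ γ ∷ʳ c → c' < c → S (c' ∷ γ)
     → Reach S α j (c' ∷ γ))
  ×
  -- and if the warden passes, the prisoner has a winning move γc ↦ c'γ, c' ≥ c
  (∃[ γ ] ∃[ c ] ∃[ c' ] (β ≡ γ ∷ʳ c × c ≤ c' × S (c' ∷ γ) × Reach S α j (c' ∷ γ)))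

Reach S α j β′ = (β′ ≡ α) ⊎ Win S α j β′

data ℕ∞ : Set where
  fin : ℕ → ℕ∞
  ∞   : ℕ∞

data _≤∞_ : ℕ∞ → ℕ∞ → Set where
  fin≤fin : {a b : ℕ} → a ℕ.≤ b → fin a ≤∞ fin b
  _≤∞∞    : (x : ℕ∞) → x ≤∞ ∞

Remoteness : {k m : ℕ} → (Str k m → Set) → Str k m → Str k m → ℕ∞ → Set
Remoteness S α β (fin j) = Win S α j β × ((i : ℕ) → i ℕ.< j → ¬ Win S α i β)
Remoteness S α β ∞       = (i : ℕ) → ¬ Win S α i β

module Submission where

open import Defs
open import Data.Nat using (ℕ; suc)
import Data.Nat.Properties as ℕ
open import Data.Fin using (Fin; _<_; _≤_)
open import Data.Vec using (Vec; _∷_; _∷ʳ_)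
open import Data.Vec.Properties using (∷ʳ-injective)
open import Data.Product using (_,_)
open import Data.Empty using (⊥-elim)
open import Data.Sum using (inj₁; inj₂)
open import Relation.Binary.PropositionalEquality using (_≡_; refl)

-- Lowering the last symbol shrinks the set of warden moves (c' < c) and
-- enlarges the set of prisoner moves after a pass (c ≤ c'), while the
-- resulting positions c'γ are the same; so every winning strategy survives.
Win-lowerLast : ∀ {k m} {S : Str k m → Set} {α : Str k m}
  (γ : Vec (Fin k) m) {a₁ a₂ : Fin k} → a₁ ≤ a₂
  → ∀ j → Win S α j (γ ∷ʳ a₂) → Win S α j (γ ∷ʳ a₁)
Win-lowerLast {S = S} {α} γ {a₁} {a₂} a₁≤a₂ (suc j) (wardenMoves , (γ' , c , c' , eq , c≤c' , s , reach))
  with ∷ʳ-injective γ γ' eq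
... | refl , refl = wardenMoves₁ , (γ , a₁ , c' , refl , ℕ.≤-trans a₁≤a₂ c≤c' , s , reach)
  where
  wardenMoves₁ : ∀ γ'' c'' d → γ ∷ʳ a₁ ≡ γ'' ∷ʳ c'' → d < c'' → S (d ∷ γ'') → Reach S α j (d ∷ γ'')
  wardenMoves₁ γ'' c'' d eq₁ d<c'' s₁ with ∷ʳ-injective γ γ'' eq₁
  ... | refl , refl = wardenMoves γ a₂ d refl (ℕ.<-≤-trans d<c'' a₁≤a₂) s₁

Remoteness-mono : ∀ {k m} {S : Str k m → Set} {α β₁ β₂ : Str k m}
  → (∀ j → Win S α j β₂ → Win S α j β₁)
  → ∀ {r₁ r₂} → Remoteness S α β₁ r₁ → Remoteness S α β₂ r₂ → r₁ ≤∞ r₂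
Remoteness-mono win₂⇒win₁ {r₁} {∞} _ _ = r₁ ≤∞∞
Remoteness-mono win₂⇒win₁ {∞} {fin b} never₁ (win₂ , _) = ⊥-elim (never₁ b (win₂⇒win₁ b win₂))
Remoteness-mono win₂⇒win₁ {fin a} {fin b} (_ , minimal₁) (win₂ , _) with ℕ.≤-<-connex a b
... | inj₁ a≤b = fin≤fin a≤b
... | inj₂ b<a = ⊥-elim (minimal₁ b b<a (win₂⇒win₁ b win₂))

mainTheorem5 : (k m : ℕ) (S : Str k m → Set) (α : Str k m)
    → RotClosed S → S α
    → (γ : Vec (Fin k) m) (a₁ a₂ : Fin k) → a₁ < a₂
    → S (γ ∷ʳ a₁) → S (γ ∷ʳ a₂)
    → (r₁ r₂ : ℕ∞) → Remoteness S α (γ ∷ʳ a₁) r₁ → Remoteness S α (γ ∷ʳ a₂) r₂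
    → r₁ ≤∞ r₂
mainTheorem5 k m S α _ _ γ a₁ a₂ a₁<a₂ _ _ r₁ r₂ =
  Remoteness-mono (Win-lowerLast γ (ℕ.<⇒≤ a₁<a₂))
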